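{- Let $n\ge 3$ and let $P(G(n))$ be the power graph of the gyrogroup $(G(n),\oplus)$ described in the context. Then its Hosoya polynomial is $$H(P(G(n)),x)=2^n x^0+\frac{2^{n-1}(2^{n-1}+1)}{2}x^1+\frac{3\cdot 2^{n-1}(2^{n-1}-1)}{2}x^2.$$
   Context: Let $n\ge 3$ and $m=2^{n-1}$. Put $P(n)=\{0,1,\dots,m-1\}$, $H(n)=\{m,m+1,\dots,2^n-1\}$ and $G(n)=P(n)\cup H(n)$. Define a binary operation $\oplus$ on $G(n)$ by: $i\oplus j=t$ if $(i,j)\in P(n)\times P(n)$; $i\oplus j=t+m$ if $(i,j)\in P(n)\times H(n)$; $i\oplus j=s+m$ if $(i,j)\in H(n)\times P(n)$; $i\oplus j=k$ if $(i,j)\in H(n)\times H(n)$, where $t,s,k\in P(n)$ are determined by $t\equiv i+j$, $s\equiv i+(\tfrac m2-1)j$, $k\equiv(\tfrac m2+1)i+(\tfrac m2-1)j \pmod m$. Then $(G(n),\oplus)$ is a gyrogroup with identity $e=0$. Powers are defined by $a^1=a$, $a^{k+1}=a\oplus a^k$. The power graph $P(G(n))$ is the simple undirected graph with vertex set $G(n)$ in which two distinct vertices $u,v$ are adjacent if and only if $u^k=v$ or $v^k=u$ for some positive integer $k$. For a connected graph $G$, $dis(G,i)$ denotes the number of unordered pairs $\{u,v\}$ of (not necessarily distinct) vertices with shortest-path distance $d(u,v)=i$, and the Hosoya polynomial is $H(G,x)=\sum_{i\ge 0} dis(G,i)x^i$. -}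

module Defs where

open import Data.Nat using (ℕ; zero; suc; _+_; _*_; _∸_; _^_; _/_; _≤_; _<_; _<ᵇ_)
open import Data.Nat.DivMod using (_%_)
open import Data.Nat.Properties using (m^n≢0)
open import Data.Bool using (if_then_else_)
open import Data.Product using (Σ; ∃; _×_; _,_)
open import Data.Sum using (_⊎_)
open import Data.List using (List; length)
open import Data.List.Membership.Propositional using (_∈_)
open import Data.List.Relation.Unary.Unique.Propositional using (Unique)
open import Function.Bundles using (_⇔_)
open import Relation.Nullary using (¬_)
open import Relation.Binary.PropositionalEquality using (_≡_)

half : ℕ → ℕ
half n = 2 ^ (n ∸ 1)

modm : ℕ → ℕ → ℕ
modm n x = _%_ x (2 ^ (n ∸ 1)) {{m^n≢0 2 (n ∸ 1)}}

-- The gyrogroup operation on G(n) = {0,…,2^n - 1}; P(n) = [0,m), H(n) = [m,2^n).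
gop : ℕ → ℕ → ℕ → ℕ
gop n i j =
  if i <ᵇ m
  then (if j <ᵇ m
        then modm n (i + j)
        else modm n (i + j) + m)
  else (if j <ᵇ m
        then modm n (i + (m / 2 ∸ 1) * j) + m
        else modm n ((m / 2 + 1) * i + (m / 2 ∸ 1) * j))
  where
  m = half n

gpow : ℕ → ℕ → ℕ → ℕ
gpow n a zero = a            -- value at k = 0 is never used (k ≥ 1 below)
gpow n a (suc zero) = a
gpow n a (suc (suc k)) = gop n a (gpow n a (suc k))

Vertex : ℕ → ℕ → Set
Vertex n u = u < 2 ^ n

IsPowerOf : ℕ → ℕ → ℕ → Set
IsPowerOf n u v = Σ ℕ λ k → 1 ≤ k × gpow n v k ≡ u

Adj : ℕ → ℕ → ℕ → Set
Adj n u v = Vertex n u × Vertex n v × ¬ (u ≡ v) × (IsPowerOf n v u ⊎ IsPowerOf n u v)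

data Walk (n : ℕ) : ℕ → ℕ → ℕ → Set where
  here : ∀ {u} → Vertex n u → Walk n u u zero
  step : ∀ {u v w d} → Adj n u v → Walk n v w d → Walk n u w (suc d)

Dist : ℕ → ℕ → ℕ → ℕ → Set
Dist n u v i = Walk n u v i × (∀ j → j < i → ¬ Walk n u v j)

HasCard : {A : Set} → (A → Set) → ℕ → Set
HasCard {A} P c = Σ (List A) λ L → Unique L × length L ≡ c × (∀ x → (x ∈ L) ⇔ P x)

-- unordered pairs {u,v} (represented as (u,v) with u ≤ v) at distance i
DisPred : ℕ → ℕ → ℕ × ℕ → Set
DisPred n i (u , v) = u ≤ v × Dist n u v i

Dis : ℕ → ℕ → ℕ → Set
Dis n i c = HasCard (DisPred n i) c

hosoyaCoeff : ℕ → ℕ → ℕ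
hosoyaCoeff n zero = 2 ^ n
hosoyaCoeff n (suc zero) = (half n * (half n + 1)) / 2
hosoyaCoeff n (suc (suc zero)) = (3 * half n * (half n ∸ 1)) / 2
hosoyaCoeff n (suc (suc (suc _))) = 0

{-# OPTIONS --safe #-}
-- On P(n) the operation is addition modulo m = 2^(n-1), and in ℤ/2^e of any two
-- elements one is a multiple of the other (odd elements are units, and two even
-- elements can both be halved), so P(n) is a clique of the power graph. Every
-- h ∈ H(n) satisfies h ⊕ h = 0 and h ⊕ 0 = h, so the powers of h alternate
-- between h and 0, while all powers of an element of P(n) stay in P(n). Hence
-- P(G(n)) is the complete graph on P(n) with one pendant edge 0 — h for every
-- h ∈ H(n). Since 0 is adjacent to every other vertex, distances are at most 2:
-- the C(m,2) + m edges are the pairs at distance 1, and the (m-1)·m pairs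
-- {p, h} with p ≠ 0 together with the C(m,2) pairs inside H(n) are at distance 2.
module Submission where

open import Defs
open import Data.Nat
  using (ℕ; zero; suc; _+_; _*_; _∸_; _^_; _/_; _%_; _≤_; _<_; _≟_; _<?_; _<ᵇ_; z≤n; s≤s; NonZero)
open import Data.Nat.Properties
open import Data.Nat.DivMod
  using (%-distribˡ-+; m%n%n≡m%n; m%n<n; m<n⇒m%n≡m; m≤n⇒[n∸m]%m≡n%m; [m+kn]%n≡m%n; m*n%n≡0; m*n/n≡m)
open import Data.Nat.Combinatorics using (_C_; nC1≡n; nCk+nC[k+1]≡[n+1]C[k+1])
open import Data.Nat.Tactic.RingSolver using (solve)
open import Data.Bool using (true; false)
open import Data.Bool.Properties using (T-≡)
open import Data.Empty using (⊥-elim)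
open import Data.Product using (∃; ∃₂; _×_; _,_; proj₁; proj₂)
open import Data.Sum using (_⊎_; inj₁; inj₂; [_,_]) renaming (map to ⊎-map)
open import Data.List using (List; []; _∷_; _++_; map; length; applyUpTo; cartesianProduct)
open import Data.List.Properties using (length-++; length-map; length-applyUpTo)
open import Data.List.Membership.Propositional using (_∈_)
open import Data.List.Membership.Propositional.Properties
  using (∈-++⁻; ∈-++⁺ˡ; ∈-++⁺ʳ; ∈-map⁻; ∈-map⁺; ∈-applyUpTo⁻; ∈-applyUpTo⁺;
         ∈-cartesianProduct⁻; ∈-cartesianProduct⁺)
open import Data.List.Relation.Unary.AllPairs using ([])
open import Data.List.Relation.Unary.Unique.Propositional.Properties
  using (++⁺; map⁺; cartesianProduct⁺; applyUpTo⁺₁)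
open import Level using (0ℓ)
open import Function using (_∘_)
open import Function.Bundles using (_⇔_; mk⇔; Equivalence)
open import Relation.Nullary using (¬_; yes; no)
open import Relation.Unary using (Pred; _⊆_; _≐_; _∪_; _⟨×⟩_; _⊥_)
open import Relation.Binary.PropositionalEquality
  using (_≡_; _≢_; refl; sym; trans; cong; cong₂; subst; module ≡-Reasoning)

open Equivalence using (to; from)
open ≡-Reasoning

module _ {A : Set} where

  HasCard-≐ : {P Q : Pred A 0ℓ} {c : ℕ} → P ≐ Q → HasCard P c → HasCard Q c
  HasCard-≐ (P⊆Q , Q⊆P) (xs , unique , len , mem) =
    xs , unique , len , λ x → mk⇔ (P⊆Q ∘ to (mem x)) (from (mem x) ∘ Q⊆P)

  HasCard-empty : {P : Pred A 0ℓ} → (∀ x → ¬ P x) → HasCard P 0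
  HasCard-empty ¬P = [] , [] , refl , λ x → mk⇔ (λ ()) (⊥-elim ∘ ¬P x)

  HasCard-∪ : {P Q : Pred A 0ℓ} {a b : ℕ} →
              P ⊥ Q → HasCard P a → HasCard Q b → HasCard (P ∪ Q) (a + b)
  HasCard-∪ {P = P} {Q} P⊥Q (xs , xs-unique , refl , xs-mem) (ys , ys-unique , refl , ys-mem) =
    xs ++ ys , ++⁺ xs-unique ys-unique disjoint , length-++ xs , mem
    where
    disjoint : ∀ {x} → ¬ (x ∈ xs × x ∈ ys)
    disjoint (x∈xs , x∈ys) = P⊥Q (to (xs-mem _) x∈xs , to (ys-mem _) x∈ys)
    mem : ∀ x → (x ∈ xs ++ ys) ⇔ (P ∪ Q) x
    mem x = mk⇔ ([ inj₁ ∘ to (xs-mem x) , inj₂ ∘ to (ys-mem x) ] ∘ ∈-++⁻ xs)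
                [ ∈-++⁺ˡ ∘ from (xs-mem x) , ∈-++⁺ʳ xs ∘ from (ys-mem x) ]

length-cartesianProduct : {A B : Set} (xs : List A) (ys : List B) →
                          length (cartesianProduct xs ys) ≡ length xs * length ys
length-cartesianProduct []       ys = refl
length-cartesianProduct (x ∷ xs) ys = begin
  length (map (x ,_) ys ++ cartesianProduct xs ys)
    ≡⟨ length-++ (map (x ,_) ys) ⟩
  length (map (x ,_) ys) + length (cartesianProduct xs ys)
    ≡⟨ cong₂ _+_ (length-map (x ,_) ys) (length-cartesianProduct xs ys) ⟩
  length ys + length xs * length ys
    ∎

HasCard-⟨×⟩ : {A B : Set} {P : Pred A 0ℓ} {Q : Pred B 0ℓ} {a b : ℕ} →
              HasCard P a → HasCard Q b → HasCard (P ⟨×⟩ Q) (a * b)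
HasCard-⟨×⟩ {P = P} {Q} (xs , xs-unique , refl , xs-mem) (ys , ys-unique , refl , ys-mem) =
  cartesianProduct xs ys , cartesianProduct⁺ xs-unique ys-unique , length-cartesianProduct xs ys , mem
  where
  mem : ∀ xy → (xy ∈ cartesianProduct xs ys) ⇔ (P ⟨×⟩ Q) xy
  mem (x , y) = mk⇔
    (λ xy∈ → let x∈ , y∈ = ∈-cartesianProduct⁻ xs ys xy∈ in
             to (xs-mem x) x∈ , to (ys-mem y) y∈)
    (λ (Px , Qy) → ∈-cartesianProduct⁺ (from (xs-mem x) Px) (from (ys-mem y) Qy))

Diagonal : {A : Set} → Pred A 0ℓ → Pred (A × A) 0ℓ
Diagonal P (x , y) = x ≡ y × P x

HasCard-Diagonal : {A : Set} {P : Pred A 0ℓ} {c : ℕ} → HasCard P c → HasCard (Diagonal P) c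
HasCard-Diagonal {P = P} (xs , unique , refl , xs-mem) =
  map (λ x → x , x) xs , map⁺ (cong proj₁) unique , length-map _ xs , mem
  where
  mem : ∀ xy → (xy ∈ map (λ x → x , x) xs) ⇔ Diagonal P xy
  mem (x , y) = mk⇔ diagonal listed
    where
    listed : Diagonal P (x , y) → (x , y) ∈ map (λ x → x , x) xs
    listed (refl , Px) = ∈-map⁺ _ (from (xs-mem x) Px)
    diagonal : (x , y) ∈ map (λ x → x , x) xs → Diagonal P (x , y)
    diagonal xy∈ with z , z∈ , refl ← ∈-map⁻ _ xy∈ = refl , to (xs-mem z) z∈

InRange : ℕ → ℕ → Pred ℕ 0ℓ
InRange a l x = a ≤ x × x < a + l

HasCard-InRange : ∀ a l → HasCard (InRange a l) l
HasCard-InRange a l =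
  applyUpTo (a +_) l , applyUpTo⁺₁ (a +_) l (λ i<j _ → <⇒≢ (+-monoʳ-< a i<j)) ,
  length-applyUpTo (a +_) l , λ x → mk⇔ in-range (listed x)
  where
  in-range : ∀ {x} → x ∈ applyUpTo (a +_) l → InRange a l x
  in-range x∈ with i , i<l , refl ← ∈-applyUpTo⁻ (a +_) x∈ = m≤m+n a i , +-monoʳ-< a i<l
  listed : ∀ x → InRange a l x → x ∈ applyUpTo (a +_) l
  listed x (a≤x , x<a+l) = subst (_∈ applyUpTo (a +_) l) (m+[n∸m]≡n a≤x)
    (∈-applyUpTo⁺ (a +_) (subst (x ∸ a <_) (m+n∸m≡n a l) (∸-monoˡ-< x<a+l a≤x)))

Ascending : ℕ → ℕ → Pred (ℕ × ℕ) 0ℓ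
Ascending a l (u , v) = a ≤ u × u < v × v < a + l

Ascending-suc : ∀ a l →
                Ascending a l ∪ (InRange a l ⟨×⟩ InRange (a + l) 1) ≐ Ascending a (suc l)
Ascending-suc a l = split , join
  where
  a+l+1≡a+[1+l] : a + l + 1 ≡ a + suc l
  a+l+1≡a+[1+l] = trans (+-assoc a l 1) (cong (a +_) (+-comm l 1))
  split : Ascending a l ∪ (InRange a l ⟨×⟩ InRange (a + l) 1) ⊆ Ascending a (suc l)
  split {u , v} (inj₁ (a≤u , u<v , v<a+l)) = a≤u , u<v , <-≤-trans v<a+l (+-monoʳ-≤ a (n≤1+n l))
  split {u , v} (inj₂ ((a≤u , u<a+l) , (a+l≤v , v<a+l+1))) =
    a≤u , <-≤-trans u<a+l a+l≤v , subst (v <_) a+l+1≡a+[1+l] v<a+l+1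
  join : Ascending a (suc l) ⊆ Ascending a l ∪ (InRange a l ⟨×⟩ InRange (a + l) 1)
  join {u , v} (a≤u , u<v , v<a+1+l) with v <? a + l
  ... | yes v<a+l = inj₁ (a≤u , u<v , v<a+l)
  ... | no  v≮a+l = inj₂ ((a≤u , <-≤-trans u<v (≤-pred (subst (v <_) (+-suc a l) v<a+1+l))) ,
                          (≮⇒≥ v≮a+l , subst (v <_) (sym a+l+1≡a+[1+l]) v<a+1+l))

HasCard-Ascending : ∀ a l → HasCard (Ascending a l) (l C 2)
HasCard-Ascending a zero = HasCard-empty λ where
  (u , v) (a≤u , u<v , v<a+0) →
    <⇒≱ v<a+0 (subst (_≤ v) (sym (+-identityʳ a)) (<⇒≤ (≤-<-trans a≤u u<v)))
HasCard-Ascending a (suc l) =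
  subst (HasCard (Ascending a (suc l))) count
    (HasCard-≐ (Ascending-suc a l)
      (HasCard-∪ disjoint (HasCard-Ascending a l)
        (HasCard-⟨×⟩ (HasCard-InRange a l) (HasCard-InRange (a + l) 1))))
  where
  disjoint : Ascending a l ⊥ (InRange a l ⟨×⟩ InRange (a + l) 1)
  disjoint {u , v} ((_ , _ , v<a+l) , (_ , (a+l≤v , _))) = <⇒≱ v<a+l a+l≤v
  count : l C 2 + l * 1 ≡ suc l C 2
  count = begin
    l C 2 + l * 1 ≡⟨ cong (l C 2 +_) (trans (*-identityʳ l) (sym (nC1≡n l))) ⟩
    l C 2 + l C 1 ≡⟨ +-comm (l C 2) (l C 1) ⟩
    l C 1 + l C 2 ≡⟨ nCk+nC[k+1]≡[n+1]C[k+1] l 1 ⟩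
    suc l C 2     ∎

m*[m∸1]+2*m≡m*[m+1] : ∀ m → m * (m ∸ 1) + 2 * m ≡ m * (m + 1)
m*[m∸1]+2*m≡m*[m+1] zero    = refl
m*[m∸1]+2*m≡m*[m+1] (suc m) = identity
  where
  identity : suc m * m + 2 * suc m ≡ suc m * (suc m + 1)
  identity = solve (m ∷ [])

2*[mC2]≡m*[m∸1] : ∀ m → 2 * (m C 2) ≡ m * (m ∸ 1)
2*[mC2]≡m*[m∸1] zero    = refl
2*[mC2]≡m*[m∸1] (suc m) = begin
  2 * (suc m C 2)     ≡⟨ cong (2 *_) (sym (nCk+nC[k+1]≡[n+1]C[k+1] m 1)) ⟩
  2 * (m C 1 + m C 2) ≡⟨ cong (λ c → 2 * (c + m C 2)) (nC1≡n m) ⟩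
  2 * (m + m C 2)     ≡⟨ *-distribˡ-+ 2 m (m C 2) ⟩
  2 * m + 2 * (m C 2) ≡⟨ +-comm (2 * m) _ ⟩
  2 * (m C 2) + 2 * m ≡⟨ cong (_+ 2 * m) (2*[mC2]≡m*[m∸1] m) ⟩
  m * (m ∸ 1) + 2 * m ≡⟨ m*[m∸1]+2*m≡m*[m+1] m ⟩
  m * (m + 1)         ≡⟨ solve (m ∷ []) ⟩
  suc m * m           ∎

m*[m+1]/2≡mC2+1*m : ∀ m → m * (m + 1) / 2 ≡ m C 2 + 1 * m
m*[m+1]/2≡mC2+1*m m = trans (cong (_/ 2) doubled) (m*n/n≡m (m C 2 + 1 * m) 2)
  where
  doubled : m * (m + 1) ≡ (m C 2 + 1 * m) * 2
  doubled = begin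
    m * (m + 1)         ≡⟨ m*[m∸1]+2*m≡m*[m+1] m ⟨
    m * (m ∸ 1) + 2 * m ≡⟨ cong (_+ 2 * m) (2*[mC2]≡m*[m∸1] m) ⟨
    2 * (m C 2) + 2 * m ≡⟨ identity (m C 2) ⟩
    (m C 2 + 1 * m) * 2 ∎
    where
    identity : ∀ c → 2 * c + 2 * m ≡ (c + 1 * m) * 2
    identity c = solve (c ∷ m ∷ [])

3*m*[m∸1]/2≡[m∸1]*m+mC2 : ∀ m → 3 * m * (m ∸ 1) / 2 ≡ (m ∸ 1) * m + m C 2
3*m*[m∸1]/2≡[m∸1]*m+mC2 m = trans (cong (_/ 2) doubled) (m*n/n≡m ((m ∸ 1) * m + m C 2) 2)
  where
  doubled : 3 * m * (m ∸ 1) ≡ ((m ∸ 1) * m + m C 2) * 2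
  doubled = begin
    3 * m * (m ∸ 1)                   ≡⟨ split (m ∸ 1) ⟩
    2 * ((m ∸ 1) * m) + m * (m ∸ 1)   ≡⟨ cong (2 * ((m ∸ 1) * m) +_) (2*[mC2]≡m*[m∸1] m) ⟨
    2 * ((m ∸ 1) * m) + 2 * (m C 2)   ≡⟨ *-distribˡ-+ 2 ((m ∸ 1) * m) (m C 2) ⟨
    2 * ((m ∸ 1) * m + m C 2)         ≡⟨ *-comm 2 ((m ∸ 1) * m + m C 2) ⟩
    ((m ∸ 1) * m + m C 2) * 2         ∎
    where
    split : ∀ t → 3 * m * t ≡ 2 * (t * m) + m * t
    split t = solve (m ∷ t ∷ [])

<⇒<ᵇ≡true : ∀ {m n} → m < n → (m <ᵇ n) ≡ true
<⇒<ᵇ≡true = to T-≡ ∘ <⇒<ᵇ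

≥⇒<ᵇ≡false : ∀ {m n} → n ≤ m → (m <ᵇ n) ≡ false
≥⇒<ᵇ≡false {n = zero}      _         = refl
≥⇒<ᵇ≡false {suc m} {suc n} (s≤s n≤m) = ≥⇒<ᵇ≡false n≤m

[m+n%d]%d≡[m+n]%d : ∀ m n d .{{_ : NonZero d}} → (m + n % d) % d ≡ (m + n) % d
[m+n%d]%d≡[m+n]%d m n d = begin
  (m + n % d) % d         ≡⟨ %-distribˡ-+ m (n % d) d ⟩
  (m % d + n % d % d) % d ≡⟨ cong (λ r → (m % d + r) % d) (m%n%n≡m%n n d) ⟩
  (m % d + n % d) % d     ≡⟨ %-distribˡ-+ m n d ⟨
  (m + n) % d             ∎

-- Multiples modulo a power of two

-- q ≡ x · p (mod m) for some x, written without subtraction.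
MultipleMod : ℕ → ℕ → ℕ → Set
MultipleMod m p q = ∃₂ λ x c → x * p ≡ q + c * m

data EvenOrOdd : ℕ → Set where
  even : ∀ a → EvenOrOdd (2 * a)
  odd  : ∀ a → EvenOrOdd (1 + 2 * a)

evenOrOdd : ∀ n → EvenOrOdd n
evenOrOdd zero = even 0
evenOrOdd (suc n) with evenOrOdd n
... | even a = odd a
... | odd a  = subst EvenOrOdd (cong suc (+-suc a (a + 0))) (even (suc a))

MultipleMod-1 : ∀ {p q} → q ≤ p → MultipleMod 1 p q
MultipleMod-1 {p} {q} q≤p =
  1 , p ∸ q ,
  trans (*-identityˡ p) (sym (trans (cong (q +_) (*-identityʳ (p ∸ q))) (m+[n∸m]≡n q≤p)))

MultipleMod-*2 : ∀ {m p q} → MultipleMod m p q → MultipleMod (2 * m) (2 * p) (2 * q)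
MultipleMod-*2 {m} {p} {q} (x , c , xp≡q+cm) = x , c , (begin
  x * (2 * p)      ≡⟨ solve (x ∷ p ∷ []) ⟩
  2 * (x * p)      ≡⟨ cong (2 *_) xp≡q+cm ⟩
  2 * (q + c * m)  ≡⟨ solve (q ∷ c ∷ m ∷ []) ⟩
  2 * q + c * (2 * m) ∎)

MultipleMod-of-unit : ∀ {m p} → MultipleMod m p 1 → ∀ q → MultipleMod m p q
MultipleMod-of-unit {m} {p} (x , c , xp≡1+cm) q = x * q , q * c , (begin
  x * q * p        ≡⟨ solve (x ∷ q ∷ p ∷ []) ⟩
  q * (x * p)      ≡⟨ cong (q *_) xp≡1+cm ⟩
  q * (1 + c * m)  ≡⟨ solve (q ∷ c ∷ m ∷ []) ⟩
  q + q * c * m    ∎)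

-- An inverse x of p modulo m with x·p = 1 + c·m is already an inverse modulo 2m when c is
-- even, and x + m is one when c is odd.
odd-unit-*2 : ∀ {m a} → MultipleMod m (1 + 2 * a) 1 → MultipleMod (2 * m) (1 + 2 * a) 1
odd-unit-*2 {m} {a} (x , c , xp≡1+cm) with evenOrOdd c
... | even c = x , c , trans xp≡1+cm (solve (c ∷ m ∷ []))
... | odd c  = x + m , 1 + c + a , (begin
  (x + m) * (1 + 2 * a)                   ≡⟨ *-distribʳ-+ (1 + 2 * a) x m ⟩
  x * (1 + 2 * a) + m * (1 + 2 * a)       ≡⟨ cong (_+ m * (1 + 2 * a)) xp≡1+cm ⟩
  1 + (1 + 2 * c) * m + m * (1 + 2 * a)   ≡⟨ solve (c ∷ a ∷ m ∷ []) ⟩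
  1 + (1 + c + a) * (2 * m)               ∎)

odd-unit : ∀ e a → MultipleMod (2 ^ e) (1 + 2 * a) 1
odd-unit zero    a = 1 , 2 * a , solve (a ∷ [])
odd-unit (suc e) a = odd-unit-*2 {a = a} (odd-unit e a)

MultipleMod-2^-total : ∀ e p q → MultipleMod (2 ^ e) p q ⊎ MultipleMod (2 ^ e) q p
MultipleMod-2^-total zero    p q = ⊎-map MultipleMod-1 MultipleMod-1 (≤-total q p)
MultipleMod-2^-total (suc e) p q with evenOrOdd p | evenOrOdd q
... | odd a  | _      = inj₁ (MultipleMod-of-unit (odd-unit (suc e) a) q)
... | even a | odd b  = inj₂ (MultipleMod-of-unit (odd-unit (suc e) b) (2 * a))
... | even a | even b = ⊎-map MultipleMod-*2 MultipleMod-*2 (MultipleMod-2^-total e a b)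

-- Distances in the power graph

module _ {n : ℕ} where

  Adj-sym : ∀ {u v} → Adj n u v → Adj n v u
  Adj-sym (u∈ , v∈ , u≢v , powers) = v∈ , u∈ , u≢v ∘ sym , [ inj₂ , inj₁ ] powers

  Walk-endpoints : ∀ {u v d} → Walk n u v d → Vertex n u × Vertex n v
  Walk-endpoints (here u∈)         = u∈ , u∈
  Walk-endpoints (step (u∈ , _) w) = u∈ , proj₂ (Walk-endpoints w)

  Walk-0 : ∀ {u v} → Walk n u v 0 → u ≡ v
  Walk-0 (here _) = refl

  Walk-1 : ∀ {u v} → Walk n u v 1 → Adj n u v
  Walk-1 (step uv (here _)) = uv

  Dist-1⇔Adj : ∀ {u v} → Dist n u v 1 ⇔ Adj n u v
  Dist-1⇔Adj {u} {v} =
    mk⇔ (Walk-1 ∘ proj₁) λ uv → step uv (here (proj₁ (proj₂ uv))) , no-shorter uv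
    where
    no-shorter : Adj n u v → ∀ j → j < 1 → ¬ Walk n u v j
    no-shorter (_ , _ , u≢v , _) zero    _        = u≢v ∘ Walk-0
    no-shorter _                 (suc j) (s≤s ())

  Dis-0 : Dis n 0 (2 ^ n)
  Dis-0 = HasCard-≐ (diagonal⊆ , ⊆diagonal) (HasCard-Diagonal (HasCard-InRange 0 (2 ^ n)))
    where
    diagonal⊆ : Diagonal (InRange 0 (2 ^ n)) ⊆ DisPred n 0
    diagonal⊆ (refl , _ , u∈) = ≤-refl , here u∈ , λ _ ()
    ⊆diagonal : DisPred n 0 ⊆ Diagonal (InRange 0 (2 ^ n))
    ⊆diagonal (_ , w , _) = Walk-0 w , z≤n , proj₁ (Walk-endpoints w)

module _ {n z : ℕ} (dominating : ∀ {x} → Vertex n x → x ≢ z → Adj n z x) where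

  walk-via-dominating : ∀ {u v} → Vertex n u → Vertex n v → u ≢ z → v ≢ z → Walk n u v 2
  walk-via-dominating u∈ v∈ u≢z v≢z =
    step (Adj-sym (dominating u∈ u≢z)) (step (dominating v∈ v≢z) (here v∈))

  short-walk : ∀ {u v} → Vertex n u → Vertex n v → ∃ λ d → d < 3 × Walk n u v d
  short-walk {u} {v} u∈ v∈ with u ≟ v | u ≟ z | v ≟ z
  ... | yes refl | _        | _        = 0 , s≤s z≤n , here u∈
  ... | no u≢v   | yes refl | _        = 1 , s≤s (s≤s z≤n) , step (dominating v∈ (u≢v ∘ sym)) (here v∈)
  ... | no _     | no u≢z   | yes refl = 1 , s≤s (s≤s z≤n) , step (Adj-sym (dominating u∈ u≢z)) (here v∈)
  ... | no _     | no u≢z   | no v≢z   = 2 , s≤s (s≤s (s≤s z≤n)) , walk-via-dominating u∈ v∈ u≢z v≢z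

  Dist-2⇔ : ∀ {u v} → Dist n u v 2 ⇔ (Vertex n u × Vertex n v × u ≢ v × ¬ Adj n u v)
  Dist-2⇔ {u} {v} = mk⇔ nonadjacent distance-2
    where
    nonadjacent : Dist n u v 2 → Vertex n u × Vertex n v × u ≢ v × ¬ Adj n u v
    nonadjacent (w , no-shorter) with u∈ , v∈ ← Walk-endpoints w =
      u∈ , v∈ , (λ { refl → no-shorter 0 (s≤s z≤n) (here u∈) }) ,
      λ uv → no-shorter 1 (s≤s (s≤s z≤n)) (step uv (here v∈))
    distance-2 : Vertex n u × Vertex n v × u ≢ v × ¬ Adj n u v → Dist n u v 2
    distance-2 (u∈ , v∈ , u≢v , ¬uv) = walk-via-dominating u∈ v∈ u≢z v≢z , no-shorter
      where
      u≢z : u ≢ z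
      u≢z refl = ¬uv (dominating v∈ (u≢v ∘ sym))
      v≢z : v ≢ z
      v≢z refl = ¬uv (Adj-sym (dominating u∈ u≢v))
      no-shorter : ∀ j → j < 2 → ¬ Walk n u v j
      no-shorter zero          _ = u≢v ∘ Walk-0
      no-shorter (suc zero)    _ = ¬uv ∘ Walk-1
      no-shorter (suc (suc j)) (s≤s (s≤s ()))

  ¬Dist-3+ : ∀ {u v} i → ¬ Dist n u v (3 + i)
  ¬Dist-3+ i (w , no-shorter) with u∈ , v∈ ← Walk-endpoints w with d , d<3 , w′ ← short-walk u∈ v∈ =
    no-shorter d (<-≤-trans d<3 (m≤m+n 3 i)) w′

  Dis-3+ : ∀ i → Dis n (3 + i) 0
  Dis-3+ i = HasCard-empty λ { (u , v) (_ , d) → ¬Dist-3+ i d }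

-- The gyrogroup G(k + 2)

module Gyrogroup (k : ℕ) where

  private
    n : ℕ
    n = 2 + k

    M : ℕ
    M = half n

    instance
      M-nonZero : NonZero M
      M-nonZero = m^n≢0 2 (suc k)

  0<M : 0 < M
  0<M = m^n>0 2 (suc k)

  1+[M∸1]≡M : 1 + (M ∸ 1) ≡ M
  1+[M∸1]≡M = m+[n∸m]≡n 0<M

  2^n≡M+M : 2 ^ n ≡ M + M
  2^n≡M+M = cong (M +_) (+-identityʳ M)

  P⊆Vertex : ∀ {p} → p < M → Vertex n p
  P⊆Vertex {p} p<M = subst (p <_) (sym 2^n≡M+M) (<-≤-trans p<M (m≤m+n M M))

  H-nonzero : ∀ {h} → M ≤ h → h ≢ 0
  H-nonzero M≤h h≡0 = <⇒≱ 0<M (subst (M ≤_) h≡0 M≤h)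

  H-mod : ∀ {h} → M ≤ h → h < 2 ^ n → h % M ≡ h ∸ M
  H-mod {h} M≤h h<2ⁿ = trans (sym (m≤n⇒[n∸m]%m≡n%m M≤h)) (m<n⇒m%n≡m h∸M<M)
    where
    h∸M<M : h ∸ M < M
    h∸M<M = subst (h ∸ M <_) (m+n∸m≡n M M) (∸-monoˡ-< (subst (h <_) 2^n≡M+M h<2ⁿ) M≤h)

  M/2≡2^k : M / 2 ≡ 2 ^ k
  M/2≡2^k = trans (cong (_/ 2) (*-comm 2 (2 ^ k))) (m*n/n≡m (2 ^ k) 2)

  gop-P : ∀ {p q} → p < M → q < M → gop n p q ≡ (p + q) % M
  gop-P p<M q<M rewrite <⇒<ᵇ≡true p<M | <⇒<ᵇ≡true q<M = refl

  -- The coefficients of h ⊕ h are (m/2 + 1) + (m/2 - 1) = m.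
  gop-H-self : ∀ {h} → M ≤ h → gop n h h ≡ 0
  gop-H-self {h} M≤h rewrite ≥⇒<ᵇ≡false M≤h | M/2≡2^k = trans (cong (_% M) h-sum) (m*n%n≡0 h M)
    where
    coefficients : 2 ^ k + 1 + (2 ^ k ∸ 1) ≡ M
    coefficients = trans (+-assoc (2 ^ k) 1 (2 ^ k ∸ 1))
      (cong (2 ^ k +_) (trans (m+[n∸m]≡n (m^n>0 2 k)) (sym (+-identityʳ (2 ^ k)))))
    h-sum : (2 ^ k + 1) * h + (2 ^ k ∸ 1) * h ≡ h * M
    h-sum = begin
      (2 ^ k + 1) * h + (2 ^ k ∸ 1) * h ≡⟨ *-distribʳ-+ h (2 ^ k + 1) (2 ^ k ∸ 1) ⟨
      (2 ^ k + 1 + (2 ^ k ∸ 1)) * h     ≡⟨ cong (_* h) coefficients ⟩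
      M * h                             ≡⟨ *-comm M h ⟩
      h * M                             ∎

  gop-H-0 : ∀ {h} → M ≤ h → h < 2 ^ n → gop n h 0 ≡ h
  gop-H-0 {h} M≤h h<2ⁿ rewrite ≥⇒<ᵇ≡false M≤h | <⇒<ᵇ≡true 0<M | *-zeroʳ (M / 2 ∸ 1) | +-identityʳ h =
    trans (cong (_+ M) (H-mod M≤h h<2ⁿ)) (m∸n+n≡m M≤h)

  gpow-P : ∀ {p K} → p < M → 1 ≤ K → gpow n p K ≡ (K * p) % M
  gpow-P {p} {suc zero}    p<M _ = sym (trans (cong (_% M) (+-identityʳ p)) (m<n⇒m%n≡m p<M))
  gpow-P {p} {suc (suc K)} p<M _ = begin
    gop n p (gpow n p (suc K))  ≡⟨ cong (gop n p) (gpow-P {K = suc K} p<M (s≤s z≤n)) ⟩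
    gop n p ((suc K * p) % M)   ≡⟨ gop-P p<M (m%n<n (suc K * p) M) ⟩
    (p + (suc K * p) % M) % M   ≡⟨ [m+n%d]%d≡[m+n]%d p (suc K * p) M ⟩
    (suc (suc K) * p) % M       ∎

  gpow-H : ∀ {h K} → M ≤ h → h < 2 ^ n → 1 ≤ K → gpow n h K ≡ h ⊎ gpow n h K ≡ 0
  gpow-H {K = suc zero}    _   _    _ = inj₁ refl
  gpow-H {h} {suc (suc K)} M≤h h<2ⁿ _ with gpow-H {K = suc K} M≤h h<2ⁿ (s≤s z≤n)
  ... | inj₁ hᴷ≡h = inj₂ (trans (cong (gop n h) hᴷ≡h) (gop-H-self M≤h))
  ... | inj₂ hᴷ≡0 = inj₁ (trans (cong (gop n h) hᴷ≡0) (gop-H-0 M≤h h<2ⁿ))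

  powers-of-P : ∀ {p u} → p < M → IsPowerOf n u p → u < M
  powers-of-P {p} p<M (K , 1≤K , pᴷ≡u) =
    subst (_< M) (trans (sym (gpow-P p<M 1≤K)) pᴷ≡u) (m%n<n (K * p) M)

  powers-of-H : ∀ {h u} → M ≤ h → h < 2 ^ n → IsPowerOf n u h → u ≡ h ⊎ u ≡ 0
  powers-of-H M≤h h<2ⁿ (K , 1≤K , hᴷ≡u) =
    ⊎-map (trans (sym hᴷ≡u)) (trans (sym hᴷ≡u)) (gpow-H M≤h h<2ⁿ 1≤K)

  multiple⇒power : ∀ {p q} → p < M → q < M → MultipleMod M p q → IsPowerOf n q p
  multiple⇒power {p} {q} p<M q<M (x , c , xp≡q+cM) = x + M , 1≤x+M , (begin
    gpow n p (x + M)        ≡⟨ gpow-P p<M 1≤x+M ⟩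
    (x + M) * p % M         ≡⟨ cong (_% M) (*-distribʳ-+ p x M) ⟩
    (x * p + M * p) % M     ≡⟨ cong (λ y → (y + M * p) % M) xp≡q+cM ⟩
    (q + c * M + M * p) % M ≡⟨ cong (_% M) (regroup M) ⟩
    (q + (c + p) * M) % M   ≡⟨ [m+kn]%n≡m%n q (c + p) M ⟩
    q % M                   ≡⟨ m<n⇒m%n≡m q<M ⟩
    q                       ∎)
    where
    1≤x+M : 1 ≤ x + M
    1≤x+M = ≤-trans 0<M (m≤n+m M x)
    regroup : ∀ m → q + c * m + m * p ≡ q + (c + p) * m
    regroup m = solve (q ∷ c ∷ m ∷ p ∷ [])

  P-clique : ∀ {p q} → p < M → q < M → p ≢ q → Adj n p q
  P-clique {p} {q} p<M q<M p≢q = P⊆Vertex p<M , P⊆Vertex q<M , p≢q ,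
    ⊎-map (multiple⇒power p<M q<M) (multiple⇒power q<M p<M) (MultipleMod-2^-total (suc k) p q)

  0-adjacent-H : ∀ {h} → M ≤ h → h < 2 ^ n → Adj n 0 h
  0-adjacent-H M≤h h<2ⁿ =
    P⊆Vertex 0<M , h<2ⁿ , H-nonzero M≤h ∘ sym , inj₂ (2 , s≤s z≤n , gop-H-self M≤h)

  0-dominating : ∀ {x} → Vertex n x → x ≢ 0 → Adj n 0 x
  0-dominating {x} x∈ x≢0 with x <? M
  ... | yes x<M = P-clique 0<M x<M (x≢0 ∘ sym)
  ... | no  x≮M = 0-adjacent-H (≮⇒≥ x≮M) x∈

  P-nonadjacent-H : ∀ {p h} → p ≢ 0 → p < M → M ≤ h → ¬ Adj n p h
  P-nonadjacent-H _   p<M M≤h (_ , _  , _   , inj₁ h-power) = <⇒≱ (powers-of-P p<M h-power) M≤h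
  P-nonadjacent-H p≢0 p<M M≤h (_ , h∈ , p≢h , inj₂ p-power) = [ p≢h , p≢0 ] (powers-of-H M≤h h∈ p-power)

  H-independent : ∀ {h h′} → M ≤ h → M ≤ h′ → ¬ Adj n h h′
  H-independent M≤h M≤h′ (h∈ , _ , h≢h′ , inj₁ h′-power) =
    [ h≢h′ ∘ sym , H-nonzero M≤h′ ] (powers-of-H M≤h h∈ h′-power)
  H-independent M≤h M≤h′ (_ , h′∈ , h≢h′ , inj₂ h-power) =
    [ h≢h′ , H-nonzero M≤h ] (powers-of-H M≤h′ h′∈ h-power)

  DisPred-1≐ : Ascending 0 M ∪ (InRange 0 1 ⟨×⟩ InRange M M) ≐ DisPred n 1
  DisPred-1≐ = at-distance-1 , λ { {u , v} (u≤v , d) → classify u≤v (to Dist-1⇔Adj d) }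
    where
    at-distance-1 : Ascending 0 M ∪ (InRange 0 1 ⟨×⟩ InRange M M) ⊆ DisPred n 1
    at-distance-1 {u , v} (inj₁ (_ , u<v , v<M)) =
      <⇒≤ u<v , from Dist-1⇔Adj (P-clique (<-trans u<v v<M) v<M (<⇒≢ u<v))
    at-distance-1 {_ , v} (inj₂ ((_ , s≤s z≤n) , (M≤v , v<M+M))) =
      z≤n , from Dist-1⇔Adj (0-adjacent-H M≤v (subst (v <_) (sym 2^n≡M+M) v<M+M))
    classify : ∀ {u v} → u ≤ v → Adj n u v →
               (Ascending 0 M ∪ (InRange 0 1 ⟨×⟩ InRange M M)) (u , v)
    classify {u} {v} u≤v uv@(_ , v∈ , u≢v , _) with v <? M | u <? M | u ≟ 0
    ... | yes v<M | _       | _        = inj₁ (z≤n , ≤∧≢⇒< u≤v u≢v , v<M)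
    ... | no  v≮M | no  u≮M | _        = ⊥-elim (H-independent (≮⇒≥ u≮M) (≮⇒≥ v≮M) uv)
    ... | no  v≮M | yes u<M | no  u≢0  = ⊥-elim (P-nonadjacent-H u≢0 u<M (≮⇒≥ v≮M) uv)
    ... | no  v≮M | yes _   | yes refl =
      inj₂ ((z≤n , s≤s z≤n) , (≮⇒≥ v≮M , subst (v <_) 2^n≡M+M v∈))

  DisPred-2≐ : (InRange 1 (M ∸ 1) ⟨×⟩ InRange M M) ∪ Ascending M M ≐ DisPred n 2
  DisPred-2≐ =
    at-distance-2 , λ { {u , v} (u≤v , d) → classify u≤v (to (Dist-2⇔ 0-dominating) d) }
    where
    at-distance-2 : (InRange 1 (M ∸ 1) ⟨×⟩ InRange M M) ∪ Ascending M M ⊆ DisPred n 2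
    at-distance-2 {u , v} (inj₁ ((0<u , u<1+[M∸1]) , (M≤v , v<M+M))) =
      <⇒≤ u<v , from (Dist-2⇔ 0-dominating)
        (P⊆Vertex u<M , subst (v <_) (sym 2^n≡M+M) v<M+M , <⇒≢ u<v ,
         P-nonadjacent-H (>⇒≢ 0<u) u<M M≤v)
      where
      u<M : u < M
      u<M = subst (u <_) 1+[M∸1]≡M u<1+[M∸1]
      u<v : u < v
      u<v = <-≤-trans u<M M≤v
    at-distance-2 {u , v} (inj₂ (M≤u , u<v , v<M+M)) =
      <⇒≤ u<v , from (Dist-2⇔ 0-dominating)
        (<-trans u<v v∈ , v∈ , <⇒≢ u<v , H-independent M≤u (<⇒≤ (≤-<-trans M≤u u<v)))
      where
      v∈ : Vertex n v
      v∈ = subst (v <_) (sym 2^n≡M+M) v<M+M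
    classify : ∀ {u v} → u ≤ v → Vertex n u × Vertex n v × u ≢ v × ¬ Adj n u v →
               ((InRange 1 (M ∸ 1) ⟨×⟩ InRange M M) ∪ Ascending M M) (u , v)
    classify {u} {v} u≤v (_ , v∈ , u≢v , ¬uv) with v <? M | u <? M | u ≟ 0
    ... | yes v<M | _       | _        = ⊥-elim (¬uv (P-clique (≤-<-trans u≤v v<M) v<M u≢v))
    ... | no  v≮M | yes _   | yes refl = ⊥-elim (¬uv (0-dominating v∈ (u≢v ∘ sym)))
    ... | no  v≮M | yes u<M | no  u≢0  =
      inj₁ ((n≢0⇒n>0 u≢0 , subst (u <_) (sym 1+[M∸1]≡M) u<M) , (≮⇒≥ v≮M , subst (v <_) 2^n≡M+M v∈))
    ... | no  v≮M | no  u≮M | _        =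
      inj₂ (≮⇒≥ u≮M , ≤∧≢⇒< u≤v u≢v , subst (v <_) 2^n≡M+M v∈)

  Dis-1 : Dis n 1 (M C 2 + 1 * M)
  Dis-1 = HasCard-≐ DisPred-1≐
    (HasCard-∪ disjoint (HasCard-Ascending 0 M)
      (HasCard-⟨×⟩ (HasCard-InRange 0 1) (HasCard-InRange M M)))
    where
    disjoint : Ascending 0 M ⊥ (InRange 0 1 ⟨×⟩ InRange M M)
    disjoint {u , v} ((_ , _ , v<M) , (_ , (M≤v , _))) = <⇒≱ v<M M≤v

  Dis-2 : Dis n 2 ((M ∸ 1) * M + M C 2)
  Dis-2 = HasCard-≐ DisPred-2≐
    (HasCard-∪ disjoint
      (HasCard-⟨×⟩ (HasCard-InRange 1 (M ∸ 1)) (HasCard-InRange M M)) (HasCard-Ascending M M))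
    where
    disjoint : (InRange 1 (M ∸ 1) ⟨×⟩ InRange M M) ⊥ Ascending M M
    disjoint {u , v} (((_ , u<1+[M∸1]) , _) , (M≤u , _)) =
      <⇒≱ (subst (u <_) 1+[M∸1]≡M u<1+[M∸1]) M≤u

lemma4p2 : (n : ℕ) → 3 ≤ n → (i : ℕ) → Dis n i (hosoyaCoeff n i)
lemma4p2 n (s≤s (s≤s (s≤s _))) 0 = Dis-0
lemma4p2 n (s≤s (s≤s (s≤s {n = k} _))) 1 =
  subst (Dis n 1) (sym (m*[m+1]/2≡mC2+1*m (half n))) (Gyrogroup.Dis-1 (suc k))
lemma4p2 n (s≤s (s≤s (s≤s {n = k} _))) 2 =
  subst (Dis n 2) (sym (3*m*[m∸1]/2≡[m∸1]*m+mC2 (half n))) (Gyrogroup.Dis-2 (suc k))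
lemma4p2 n (s≤s (s≤s (s≤s {n = k} _))) (suc (suc (suc i))) =
  Dis-3+ (Gyrogroup.0-dominating (suc k)) i
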